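{- Let $G$ be a connected $2K_2$-free graph containing an induced diamond $D$ with vertex set $L_0=\{v_1,v_2,v_3,v_4\}$ and edge set $\{v_1v_2, v_2v_3, v_3v_4, v_4v_1, v_2v_4\}$. Let $L_1$ be the set of vertices of $V(G)\setminus L_0$ having a neighbor in $L_0$, and $L_2 = V(G)\setminus(L_0\cup L_1)$. For $i\in\{1,2,3\}$ let $X_i=\{x\in L_1 : N(x)\cap L_0=\{v_i\}\}$, and let $Y_1=\{x\in L_1: N(x)\cap L_0=\{v_1,v_2\}\}$, $Y_2=\{x\in L_1: N(x)\cap L_0=\{v_2,v_3\}\}$, $Z_1=\{x\in L_1: N(x)\cap L_0=\{v_1,v_3\}\}$, $Z_2=\{x\in L_1: N(x)\cap L_0=\{v_1,v_2,v_3\}\}$. Then: (1) $V(G) = N(v_4)\cup\{v_4\}\cup X_1\cup X_2\cup X_3\cup Y_1\cup Y_2\cup Z_1\cup Z_2\cup L_2$; (2) $X_1=\emptyset$ or $X_3=\emptyset$; (3) $X_1\cup X_2\cup Y_1$, $Y_2$, $Z_1$ and $L_2$ are independent sets; (4) there is no edge between $X_1\cup X_2\cup X_3\cup Y_1\cup Y_2\cup Z_1$ and $L_2$.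
   Context: All graphs are finite, simple and undirected. $2K_2$ is the disjoint union of two edges; a graph is $2K_2$-free if it has no induced subgraph isomorphic to $2K_2$. $N(x)$ is the set of neighbors of $x$. -}

module Defs where

open import Data.Nat using (ℕ)
open import Data.Fin using (Fin)
open import Data.Product using (_×_; ∃-syntax)
open import Data.Sum using (_⊎_)
open import Data.Empty using (⊥)
open import Relation.Nullary using (¬_; Dec)
open import Relation.Binary.PropositionalEquality using (_≡_)
open import Function.Bundles using (_⇔_)

record Graph (n : ℕ) : Set₁ where
  field
    Adj    : Fin n → Fin n → Set
    sym    : ∀ {x y} → Adj x y → Adj y x
    irrefl : ∀ {x} → ¬ Adj x x
    dec    : ∀ x y → Dec (Adj x y)
open Graph public

data Walk {n : ℕ} (G : Graph n) : Fin n → Fin n → Set where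
  here : ∀ {x} → Walk G x x
  step : ∀ {x y z} → Adj G x y → Walk G y z → Walk G x z

Connected : ∀ {n} → Graph n → Set
Connected G = ∀ x y → Walk G x y

-- G contains no induced 2K2: no edges ab, cd with no edges between {a,b} and {c,d}
-- (distinctness of a,b,c,d is automatic from irreflexivity)
TwoK2Free : ∀ {n} → Graph n → Set
TwoK2Free G = ∀ a b c d → Adj G a b → Adj G c d →
  ¬ Adj G a c → ¬ Adj G a d → ¬ Adj G b c → ¬ Adj G b d → ⊥

InducedDiamond : ∀ {n} → Graph n → (v₁ v₂ v₃ v₄ : Fin n) → Set
InducedDiamond G v₁ v₂ v₃ v₄ =
  ¬ v₁ ≡ v₂ × ¬ v₁ ≡ v₃ × ¬ v₁ ≡ v₄ × ¬ v₂ ≡ v₃ × ¬ v₂ ≡ v₄ × ¬ v₃ ≡ v₄ ×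
  Adj G v₁ v₂ × Adj G v₂ v₃ × Adj G v₃ v₄ × Adj G v₄ v₁ × Adj G v₂ v₄ ×
  ¬ Adj G v₁ v₃

Independent : ∀ {n} → Graph n → (Fin n → Set) → Set
Independent G S = ∀ x y → S x → S y → ¬ Adj G x y

module Layers {n : ℕ} (G : Graph n) (v₁ v₂ v₃ v₄ : Fin n) where

  L₀ : Fin n → Set
  L₀ x = x ≡ v₁ ⊎ x ≡ v₂ ⊎ x ≡ v₃ ⊎ x ≡ v₄

  L₁ : Fin n → Set
  L₁ x = ¬ L₀ x × ∃[ y ] (L₀ y × Adj G x y)

  L₂ : Fin n → Set
  L₂ x = ¬ L₀ x × ¬ L₁ x

  NL₀≡ : Fin n → (Fin n → Set) → Set
  NL₀≡ x S = ∀ y → (L₀ y × Adj G x y) ⇔ S y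

  X₁ X₂ X₃ Y₁ Y₂ Z₁ Z₂ : Fin n → Set
  X₁ x = L₁ x × NL₀≡ x (λ y → y ≡ v₁)
  X₂ x = L₁ x × NL₀≡ x (λ y → y ≡ v₂)
  X₃ x = L₁ x × NL₀≡ x (λ y → y ≡ v₃)
  Y₁ x = L₁ x × NL₀≡ x (λ y → y ≡ v₁ ⊎ y ≡ v₂)
  Y₂ x = L₁ x × NL₀≡ x (λ y → y ≡ v₂ ⊎ y ≡ v₃)
  Z₁ x = L₁ x × NL₀≡ x (λ y → y ≡ v₁ ⊎ y ≡ v₃)
  Z₂ x = L₁ x × NL₀≡ x (λ y → y ≡ v₁ ⊎ y ≡ v₂ ⊎ y ≡ v₃)

-- In a 2K₂-free graph two vertices anticomplete to a common edge are nonadjacent.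
-- Each of X₁ ∪ X₂ ∪ Y₁, Y₂, Z₁ misses a fixed edge of the diamond and L₂ misses all
-- of them, which gives (3) and (4). For (2), x ∈ X₁ and y ∈ X₃ both miss v₂v₄: if
-- they are adjacent they form a 2K₂ with v₂v₄, otherwise xv₁ and yv₃ form one.
module Submission where

open import Defs
open import Data.Nat using (ℕ)
open import Data.Fin using (Fin; _≟_)
open import Data.Fin.Properties using (any?)
open import Data.Product using (_×_; _,_; proj₂; ∃₂; uncurry)
open import Data.Sum using (_⊎_; inj₁; inj₂; [_,_]; map₁)
open import Data.Empty using (⊥; ⊥-elim)
open import Function using (_∘_)
open import Relation.Nullary using (¬_; yes; no)
open import Relation.Nullary.Decidable using (_⊎-dec_; _×-dec_; ¬?)
open import Relation.Unary using (Decidable)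
open import Relation.Binary.PropositionalEquality using (_≡_; _≢_; refl; ≢-sym)
open import Function.Bundles using (mk⇔; Equivalence)

one-side-empty : ∀ {n} {P Q : Fin n → Set} → Decidable P →
  (∀ {x y} → P x → Q y → ⊥) → (∀ x → ¬ P x) ⊎ (∀ y → ¬ Q y)
one-side-empty P? incompatible with any? P?
... | yes (x , px) = inj₂ λ y qy → incompatible px qy
... | no  ¬∃P      = inj₁ λ x px → ¬∃P (x , px)

Misses : ∀ {n} → Graph n → Fin n → Fin n → Fin n → Set
Misses G x p q = ¬ Adj G x p × ¬ Adj G x q

module TwoK2FreeGraph {n : ℕ} (G : Graph n) (free : TwoK2Free G) where

  anticomplete-to-edge⇒nonadjacent : ∀ {p q x y} → Adj G p q →
    Misses G x p q → Misses G y p q → ¬ Adj G x y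
  anticomplete-to-edge⇒nonadjacent {p} {q} {x} {y} pq (x≁p , x≁q) (y≁p , y≁q) xy =
    free x y p q xy pq x≁p x≁q y≁p y≁q

  anticomplete-to-edge⇒independent : ∀ {p q} {S : Fin n → Set} → Adj G p q →
    (∀ {x} → S x → Misses G x p q) → Independent G S
  anticomplete-to-edge⇒independent pq misses x y sx sy =
    anticomplete-to-edge⇒nonadjacent pq (misses sx) (misses sy)

  anticomplete-to-edge⇒¬private-neighbours : ∀ {p q x y a b} → Adj G p q →
    Misses G x p q → Misses G y p q → ¬ Adj G a b →
    Adj G x a → ¬ Adj G x b → Adj G y b → ¬ Adj G y a → ⊥
  anticomplete-to-edge⇒¬private-neighbours {x = x} {y} {a} {b} pq mx my a≁b xa x≁b yb y≁a
    with dec G x y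
  ... | yes xy = anticomplete-to-edge⇒nonadjacent pq mx my xy
  ... | no x≁y = free x a y b xa yb x≁y x≁b (y≁a ∘ sym G) a≁b

module DiamondLayers {n : ℕ} (G : Graph n) (free : TwoK2Free G) {v₁ v₂ v₃ v₄ : Fin n}
  (v₁≢v₂ : v₁ ≢ v₂) (v₁≢v₃ : v₁ ≢ v₃) (v₁≢v₄ : v₁ ≢ v₄)
  (v₂≢v₃ : v₂ ≢ v₃) (v₂≢v₄ : v₂ ≢ v₄) (v₃≢v₄ : v₃ ≢ v₄)
  (v₁v₂ : Adj G v₁ v₂) (v₃v₄ : Adj G v₃ v₄) (v₄v₁ : Adj G v₄ v₁) (v₂v₄ : Adj G v₂ v₄)
  (v₁≁v₃ : ¬ Adj G v₁ v₃) where

  open Layers G v₁ v₂ v₃ v₄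
  open TwoK2FreeGraph G free

  L₀-elim : ∀ {P : Fin n → Set} → P v₁ → P v₂ → P v₃ → P v₄ → ∀ {y} → L₀ y → P y
  L₀-elim p₁ _  _  _  (inj₁ refl)                 = p₁
  L₀-elim _  p₂ _  _  (inj₂ (inj₁ refl))          = p₂
  L₀-elim _  _  p₃ _  (inj₂ (inj₂ (inj₁ refl)))   = p₃
  L₀-elim _  _  _  p₄ (inj₂ (inj₂ (inj₂ refl)))   = p₄

  L₀? : Decidable L₀
  L₀? x = (x ≟ v₁) ⊎-dec (x ≟ v₂) ⊎-dec (x ≟ v₃) ⊎-dec (x ≟ v₄)

  v₁∈L₀ : L₀ v₁
  v₁∈L₀ = inj₁ refl
  v₂∈L₀ : L₀ v₂
  v₂∈L₀ = inj₂ (inj₁ refl)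
  v₃∈L₀ : L₀ v₃
  v₃∈L₀ = inj₂ (inj₂ (inj₁ refl))
  v₄∈L₀ : L₀ v₄
  v₄∈L₀ = inj₂ (inj₂ (inj₂ refl))

  L₁-class : ∀ {x v} {S : Fin n → Set} → ¬ L₀ x → S v → (∀ {y} → S y → L₀ y × Adj G x y) →
    (Adj G x v₁ → S v₁) → (Adj G x v₂ → S v₂) → (Adj G x v₃ → S v₃) → (Adj G x v₄ → S v₄) →
    L₁ x × NL₀≡ x S
  L₁-class {x} {S = S} x∉L₀ sv sound c₁ c₂ c₃ c₄ =
    (x∉L₀ , _ , sound sv) , λ y → mk⇔ (uncurry complete) sound
    where
    complete : ∀ {y} → L₀ y → Adj G x y → S y
    complete = L₀-elim {P = λ y → Adj G x y → S y} c₁ c₂ c₃ c₄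

  adjacent : ∀ {x S v} → NL₀≡ x S → S v → Adj G x v
  adjacent {v = v} N sv = proj₂ (Equivalence.from (N v) sv)

  nonadjacent : ∀ {x S v} → NL₀≡ x S → L₀ v → ¬ S v → ¬ Adj G x v
  nonadjacent {v = v} N v∈L₀ ¬sv xv = ¬sv (Equivalence.to (N v) (v∈L₀ , xv))

  L₂-nonadjacent : ∀ {y v} → L₂ y → L₀ v → ¬ Adj G y v
  L₂-nonadjacent (y∉L₀ , y∉L₁) v∈L₀ yv = y∉L₁ (y∉L₀ , _ , v∈L₀ , yv)

  covered : ∀ x → Adj G x v₄ ⊎ x ≡ v₄ ⊎ X₁ x ⊎ X₂ x ⊎ X₃ x ⊎ Y₁ x ⊎ Y₂ x ⊎ Z₁ x ⊎ Z₂ x ⊎ L₂ x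
  covered x with L₀? x
  ... | yes (inj₁ refl)               = inj₁ (sym G v₄v₁)
  ... | yes (inj₂ (inj₁ refl))        = inj₁ v₂v₄
  ... | yes (inj₂ (inj₂ (inj₁ refl))) = inj₁ v₃v₄
  ... | yes (inj₂ (inj₂ (inj₂ refl))) = inj₂ (inj₁ refl)
  ... | no x∉L₀ with dec G x v₄
  ... | yes xv₄ = inj₁ xv₄
  ... | no x≁v₄ with dec G x v₁ | dec G x v₂ | dec G x v₃
  ... | no x≁v₁ | no x≁v₂ | no x≁v₃ =
    inj₂ (inj₂ (inj₂ (inj₂ (inj₂ (inj₂ (inj₂ (inj₂ (inj₂ (x∉L₀ ,
      λ { (_ , _ , y∈L₀ , xy) → L₀-elim {P = λ y → ¬ Adj G x y} x≁v₁ x≁v₂ x≁v₃ x≁v₄ y∈L₀ xy })))))))))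
  ... | yes xv₁ | no x≁v₂ | no x≁v₃ =
    inj₂ (inj₂ (inj₁ (L₁-class x∉L₀ refl (λ { refl → v₁∈L₀ , xv₁ })
      (λ _ → refl) (⊥-elim ∘ x≁v₂) (⊥-elim ∘ x≁v₃) (⊥-elim ∘ x≁v₄))))
  ... | no x≁v₁ | yes xv₂ | no x≁v₃ =
    inj₂ (inj₂ (inj₂ (inj₁ (L₁-class x∉L₀ refl (λ { refl → v₂∈L₀ , xv₂ })
      (⊥-elim ∘ x≁v₁) (λ _ → refl) (⊥-elim ∘ x≁v₃) (⊥-elim ∘ x≁v₄)))))
  ... | no x≁v₁ | no x≁v₂ | yes xv₃ =
    inj₂ (inj₂ (inj₂ (inj₂ (inj₁ (L₁-class x∉L₀ refl (λ { refl → v₃∈L₀ , xv₃ })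
      (⊥-elim ∘ x≁v₁) (⊥-elim ∘ x≁v₂) (λ _ → refl) (⊥-elim ∘ x≁v₄))))))
  ... | yes xv₁ | yes xv₂ | no x≁v₃ =
    inj₂ (inj₂ (inj₂ (inj₂ (inj₂ (inj₁ (L₁-class x∉L₀ (inj₁ refl)
      (λ { (inj₁ refl) → v₁∈L₀ , xv₁ ; (inj₂ refl) → v₂∈L₀ , xv₂ })
      (λ _ → inj₁ refl) (λ _ → inj₂ refl) (⊥-elim ∘ x≁v₃) (⊥-elim ∘ x≁v₄)))))))
  ... | no x≁v₁ | yes xv₂ | yes xv₃ =
    inj₂ (inj₂ (inj₂ (inj₂ (inj₂ (inj₂ (inj₁ (L₁-class x∉L₀ (inj₁ refl)
      (λ { (inj₁ refl) → v₂∈L₀ , xv₂ ; (inj₂ refl) → v₃∈L₀ , xv₃ })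
      (⊥-elim ∘ x≁v₁) (λ _ → inj₁ refl) (λ _ → inj₂ refl) (⊥-elim ∘ x≁v₄))))))))
  ... | yes xv₁ | no x≁v₂ | yes xv₃ =
    inj₂ (inj₂ (inj₂ (inj₂ (inj₂ (inj₂ (inj₂ (inj₁ (L₁-class x∉L₀ (inj₁ refl)
      (λ { (inj₁ refl) → v₁∈L₀ , xv₁ ; (inj₂ refl) → v₃∈L₀ , xv₃ })
      (λ _ → inj₁ refl) (⊥-elim ∘ x≁v₂) (λ _ → inj₂ refl) (⊥-elim ∘ x≁v₄)))))))))
  ... | yes xv₁ | yes xv₂ | yes xv₃ =
    inj₂ (inj₂ (inj₂ (inj₂ (inj₂ (inj₂ (inj₂ (inj₂ (inj₁ (L₁-class x∉L₀ (inj₁ refl)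
      (λ { (inj₁ refl) → v₁∈L₀ , xv₁ ; (inj₂ (inj₁ refl)) → v₂∈L₀ , xv₂
         ; (inj₂ (inj₂ refl)) → v₃∈L₀ , xv₃ })
      (λ _ → inj₁ refl) (λ _ → inj₂ (inj₁ refl)) (λ _ → inj₂ (inj₂ refl)) (⊥-elim ∘ x≁v₄))))))))))

  X₁-misses-v₃v₄ : ∀ {x} → X₁ x → Misses G x v₃ v₄
  X₁-misses-v₃v₄ (_ , N) = nonadjacent N v₃∈L₀ (≢-sym v₁≢v₃) , nonadjacent N v₄∈L₀ (≢-sym v₁≢v₄)

  X₂-misses-v₃v₄ : ∀ {x} → X₂ x → Misses G x v₃ v₄
  X₂-misses-v₃v₄ (_ , N) = nonadjacent N v₃∈L₀ (≢-sym v₂≢v₃) , nonadjacent N v₄∈L₀ (≢-sym v₂≢v₄)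

  Y₁-misses-v₃v₄ : ∀ {x} → Y₁ x → Misses G x v₃ v₄
  Y₁-misses-v₃v₄ (_ , N) =
    nonadjacent N v₃∈L₀ [ ≢-sym v₁≢v₃ , ≢-sym v₂≢v₃ ] ,
    nonadjacent N v₄∈L₀ [ ≢-sym v₁≢v₄ , ≢-sym v₂≢v₄ ]

  X₃-misses-v₂v₄ : ∀ {x} → X₃ x → Misses G x v₂ v₄
  X₃-misses-v₂v₄ (_ , N) = nonadjacent N v₂∈L₀ v₂≢v₃ , nonadjacent N v₄∈L₀ (≢-sym v₃≢v₄)

  Z₁-misses-v₂v₄ : ∀ {x} → Z₁ x → Misses G x v₂ v₄
  Z₁-misses-v₂v₄ (_ , N) =
    nonadjacent N v₂∈L₀ [ ≢-sym v₁≢v₂ , v₂≢v₃ ] ,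
    nonadjacent N v₄∈L₀ [ ≢-sym v₁≢v₄ , ≢-sym v₃≢v₄ ]

  Y₂-misses-v₄v₁ : ∀ {x} → Y₂ x → Misses G x v₄ v₁
  Y₂-misses-v₄v₁ (_ , N) =
    nonadjacent N v₄∈L₀ [ ≢-sym v₂≢v₄ , ≢-sym v₃≢v₄ ] ,
    nonadjacent N v₁∈L₀ [ v₁≢v₂ , v₁≢v₃ ]

  X₁-Profile : Fin n → Set
  X₁-Profile x = Adj G x v₁ × ¬ Adj G x v₃ × Misses G x v₂ v₄

  X₁-Profile? : Decidable X₁-Profile
  X₁-Profile? x = dec G x v₁ ×-dec ¬? (dec G x v₃) ×-dec ¬? (dec G x v₂) ×-dec ¬? (dec G x v₄)

  X₁⇒X₁-Profile : ∀ {x} → X₁ x → X₁-Profile x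
  X₁⇒X₁-Profile (_ , N) =
    adjacent N refl , nonadjacent N v₃∈L₀ (≢-sym v₁≢v₃) ,
    nonadjacent N v₂∈L₀ (≢-sym v₁≢v₂) , nonadjacent N v₄∈L₀ (≢-sym v₁≢v₄)

  X₁-Profile-X₃-incompatible : ∀ {x y} → X₁-Profile x → X₃ y → ⊥
  X₁-Profile-X₃-incompatible (xv₁ , x≁v₃ , x-misses) y∈X₃@(_ , N) =
    anticomplete-to-edge⇒¬private-neighbours v₂v₄ x-misses (X₃-misses-v₂v₄ y∈X₃)
      v₁≁v₃ xv₁ x≁v₃ (adjacent N refl) (nonadjacent N v₁∈L₀ v₁≢v₃)

  X₁-or-X₃-empty : (∀ x → ¬ X₁ x) ⊎ (∀ x → ¬ X₃ x)
  X₁-or-X₃-empty = map₁ (λ noProfile x → noProfile x ∘ X₁⇒X₁-Profile)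
    (one-side-empty X₁-Profile? X₁-Profile-X₃-incompatible)

  MissesAnEdgeOfL₀ : Fin n → Set
  MissesAnEdgeOfL₀ x = ∃₂ λ p q → L₀ p × L₀ q × Adj G p q × Misses G x p q

  misses-an-edge : ∀ {x} → X₁ x ⊎ X₂ x ⊎ X₃ x ⊎ Y₁ x ⊎ Y₂ x ⊎ Z₁ x → MissesAnEdgeOfL₀ x
  misses-an-edge (inj₁ h)                             = _ , _ , v₃∈L₀ , v₄∈L₀ , v₃v₄ , X₁-misses-v₃v₄ h
  misses-an-edge (inj₂ (inj₁ h))                      = _ , _ , v₃∈L₀ , v₄∈L₀ , v₃v₄ , X₂-misses-v₃v₄ h
  misses-an-edge (inj₂ (inj₂ (inj₁ h)))               = _ , _ , v₂∈L₀ , v₄∈L₀ , v₂v₄ , X₃-misses-v₂v₄ h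
  misses-an-edge (inj₂ (inj₂ (inj₂ (inj₁ h))))        = _ , _ , v₃∈L₀ , v₄∈L₀ , v₃v₄ , Y₁-misses-v₃v₄ h
  misses-an-edge (inj₂ (inj₂ (inj₂ (inj₂ (inj₁ h))))) = _ , _ , v₄∈L₀ , v₁∈L₀ , v₄v₁ , Y₂-misses-v₄v₁ h
  misses-an-edge (inj₂ (inj₂ (inj₂ (inj₂ (inj₂ h))))) = _ , _ , v₂∈L₀ , v₄∈L₀ , v₂v₄ , Z₁-misses-v₂v₄ h

  L₁-to-L₂-nonadjacent : ∀ x y → X₁ x ⊎ X₂ x ⊎ X₃ x ⊎ Y₁ x ⊎ Y₂ x ⊎ Z₁ x → L₂ y → ¬ Adj G x y
  L₁-to-L₂-nonadjacent x y hx y∈L₂ with misses-an-edge hx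
  ... | _ , _ , p∈L₀ , q∈L₀ , pq , x-misses =
    anticomplete-to-edge⇒nonadjacent pq x-misses
      (L₂-nonadjacent y∈L₂ p∈L₀ , L₂-nonadjacent y∈L₂ q∈L₀)

  X₁∪X₂∪Y₁-misses-v₃v₄ : ∀ {x} → X₁ x ⊎ X₂ x ⊎ Y₁ x → Misses G x v₃ v₄
  X₁∪X₂∪Y₁-misses-v₃v₄ = [ X₁-misses-v₃v₄ , [ X₂-misses-v₃v₄ , Y₁-misses-v₃v₄ ] ]

  L₂-misses-v₁v₂ : ∀ {x} → L₂ x → Misses G x v₁ v₂
  L₂-misses-v₁v₂ x∈L₂ = L₂-nonadjacent x∈L₂ v₁∈L₀ , L₂-nonadjacent x∈L₂ v₂∈L₀

lemma3p7 : ∀ {n} (G : Graph n) (v₁ v₂ v₃ v₄ : Fin n) →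
    Connected G → TwoK2Free G → InducedDiamond G v₁ v₂ v₃ v₄ →
    let open Layers G v₁ v₂ v₃ v₄ in
    (∀ x → Adj G x v₄ ⊎ x ≡ v₄ ⊎ X₁ x ⊎ X₂ x ⊎ X₃ x ⊎ Y₁ x ⊎ Y₂ x ⊎ Z₁ x ⊎ Z₂ x ⊎ L₂ x)
    × ((∀ x → ¬ X₁ x) ⊎ (∀ x → ¬ X₃ x))
    × Independent G (λ x → X₁ x ⊎ X₂ x ⊎ Y₁ x)
    × Independent G Y₂
    × Independent G Z₁
    × Independent G L₂
    × (∀ x y → (X₁ x ⊎ X₂ x ⊎ X₃ x ⊎ Y₁ x ⊎ Y₂ x ⊎ Z₁ x) → L₂ y → ¬ Adj G x y)
lemma3p7 G v₁ v₂ v₃ v₄ _ free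
  (v₁≢v₂ , v₁≢v₃ , v₁≢v₄ , v₂≢v₃ , v₂≢v₄ , v₃≢v₄ , v₁v₂ , _ , v₃v₄ , v₄v₁ , v₂v₄ , v₁≁v₃) =
    covered
  , X₁-or-X₃-empty
  , anticomplete-to-edge⇒independent v₃v₄ X₁∪X₂∪Y₁-misses-v₃v₄
  , anticomplete-to-edge⇒independent v₄v₁ Y₂-misses-v₄v₁
  , anticomplete-to-edge⇒independent v₂v₄ Z₁-misses-v₂v₄
  , anticomplete-to-edge⇒independent v₁v₂ L₂-misses-v₁v₂
  , L₁-to-L₂-nonadjacent
  where
  open TwoK2FreeGraph G free
  open DiamondLayers G free v₁≢v₂ v₁≢v₃ v₁≢v₄ v₂≢v₃ v₂≢v₄ v₃≢v₄ v₁v₂ v₃v₄ v₄v₁ v₂v₄ v₁≁v₃
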